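{- Let $\alpha_{ij}$ ($1\le i,j\le 3$) and $\alpha_1,\alpha_2,\alpha_3$ be constants and let sequences $(a_x),(b_x),(c_x)$, $x\ge0$, satisfy for all $x\ge1$ \[ \begin{aligned} a_x&=\alpha_{11}a_{x-1}+\alpha_{12}b_{x-1}+\alpha_{13}c_{x-1}+\alpha_1,\\ b_x&=\alpha_{21}a_{x-1}+\alpha_{22}b_{x-1}+\alpha_{23}c_{x-1}+\alpha_2,\\ c_x&=\alpha_{31}a_{x-1}+\alpha_{32}b_{x-1}+\alpha_{33}c_{x-1}+\alpha_3 . \end{aligned} \] Assume (1) $\alpha_{11}+\alpha_{12}+\alpha_{13}=\alpha_{21}+\alpha_{22}+\alpha_{23}=\alpha_{31}+\alpha_{32}+\alpha_{33}$, and (2) there exist $w_1,w_2$ with $w_1+w_2=1$ such that $b_x=w_1a_x+w_2c_x$ for all $x$. Then: (i) (assuming $w_2\neq0$) for all $x\ge1$, $a_x=\alpha'_{11}a_{x-1}+\alpha'_{12}b_{x-1}+\alpha_1$ and $b_x=\alpha'_{21}a_{x-1}+\alpha'_{22}b_{x-1}+\alpha_2$, where $\alpha'_{11}=\alpha_{11}-\frac{w_1}{w_2}\alpha_{13}$, $\alpha'_{12}=\alpha_{12}+\frac{1}{w_2}\alpha_{13}$, $\alpha'_{21}=\alpha_{21}-\frac{w_1}{w_2}\alpha_{23}$, $\alpha'_{22}=\alpha_{22}+\frac1{w_2}\alpha_{23}$; (ii) for all $x\ge1$, $a_x=\alpha'_{11}a_{x-1}+\alpha'_{12}c_{x-1}+\alpha_1$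 and $c_x=\alpha'_{21}a_{x-1}+\alpha'_{22}c_{x-1}+\alpha_3$, where $\alpha'_{11}=\alpha_{11}+w_1\alpha_{12}$, $\alpha'_{12}=w_2\alpha_{12}+\alpha_{13}$, $\alpha'_{21}=\alpha_{31}+w_1\alpha_{32}$, $\alpha'_{22}=w_2\alpha_{32}+\alpha_{33}$; (iii) (assuming $w_1\neq0$) for all $x\ge1$, $b_x=\alpha'_{11}b_{x-1}+\alpha'_{12}c_{x-1}+\alpha_2$ and $c_x=\alpha'_{21}b_{x-1}+\alpha'_{22}c_{x-1}+\alpha_3$, where $\alpha'_{11}=\frac1{w_1}\alpha_{21}+\alpha_{22}$, $\alpha'_{12}=-\frac{w_2}{w_1}\alpha_{21}+\alpha_{23}$, $\alpha'_{21}=\frac1{w_1}\alpha_{31}+\alpha_{32}$, $\alpha'_{22}=-\frac{w_2}{w_1}\alpha_{31}+\alpha_{33}$; and in each of the three pairs, $\alpha'_{11}+\alpha'_{12}=\alpha'_{21}+\alpha'_{22}$.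
   Context: All $\alpha$'s and $w$'s are constants; $x$ is a nonnegative integer index. -}

module Defs where

open import Level using (suc; _⊔_)
open import Algebra.Bundles using (CommutativeRing)
open import Relation.Nullary using (¬_)

record Field c ℓ : Set (suc (c ⊔ ℓ)) where
  field
    commutativeRing : CommutativeRing c ℓ
  open CommutativeRing commutativeRing public
  field
    inv     : (x : Carrier) → ¬ (x ≈ 0#) → Carrier
    inverse : (x : Carrier) (p : ¬ (x ≈ 0#)) → x * inv x p ≈ 1#
    0≉1     : ¬ (0# ≈ 1#)

  div : Carrier → (y : Carrier) → ¬ (y ≈ 0#) → Carrier
  div x y p = x * inv y p

-- Since b = w₁ a + w₂ c with w₁ + w₂ = 1, each of a, b, c is an affine combination
-- (weights summing to 1) of the other two; isolating c or a needs w₂ resp. w₁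
-- invertible. Substituting X = u Y + v Z into r X + p Y + q Z + k gives
-- (u r + p) Y + (v r + q) Z + k, whose coefficient sum is (u + v) r + p + q = r + p + q,
-- so rows with equal coefficient sums keep equal coefficient sums.

module Submission where

open import Defs
open import Data.Nat using (ℕ; suc)
open import Data.Product using (_×_; _,_)
open import Relation.Nullary using (¬_)
open import Algebra.Bundles using (CommutativeRing)

module AffineElimination {c ℓ} (R : CommutativeRing c ℓ) (I : Set) where
  open CommutativeRing R
  open import Algebra.Properties.CommutativeSemigroup +-commutativeSemigroup
    using (xy∙z≈yx∙z; xy∙z≈zx∙y)
  open import Algebra.Solver.Ring.NaturalCoefficients.Default commutativeSemiring
    using (solve; _:=_; _:+_; _:*_)
  open import Relation.Binary.Reasoning.Setoid setoid

  Family : Set c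
  Family = I → Carrier

  AffineCombination : (X Y Z : Family) (u v : Carrier) → Set ℓ
  AffineCombination X Y Z u v = (u + v ≈ 1#) × (∀ x → X x ≈ u * Y x + v * Z x)

  AffineIn₃ : (S X Y Z : Family) (r p q k : Carrier) → Set ℓ
  AffineIn₃ S X Y Z r p q k = ∀ x → S x ≈ r * X x + p * Y x + q * Z x + k

  AffineIn₂ : (S Y Z : Family) (p q k : Carrier) → Set ℓ
  AffineIn₂ S Y Z p q k = ∀ x → S x ≈ p * Y x + q * Z x + k

  BalancedPair : (S T Y Z : Family) (p₁ q₁ k₁ p₂ q₂ k₂ : Carrier) → Set ℓ
  BalancedPair S T Y Z p₁ q₁ k₁ p₂ q₂ k₂ =
    AffineIn₂ S Y Z p₁ q₁ k₁ × AffineIn₂ T Y Z p₂ q₂ k₂ × (p₁ + q₁ ≈ p₂ + q₂)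

  AffineCombination-swap : ∀ {X Y Z u v} →
    AffineCombination X Y Z u v → AffineCombination X Z Y v u
  AffineCombination-swap (u+v≈1 , X≈) =
    trans (+-comm _ _) u+v≈1 , λ x → trans (X≈ x) (+-comm _ _)

  AffineCombination-isolate : ∀ {X Y Z w₁ w₂ i} → w₂ * i ≈ 1# →
    AffineCombination Y X Z w₁ w₂ → AffineCombination Z X Y (- (w₁ * i)) (1# * i)
  AffineCombination-isolate {X} {Y} {Z} {w₁} {w₂} {i} w₂i≈1 (w₁+w₂≈1 , Y≈) =
    weights , combination
    where
    n = - (w₁ * i)

    n+w₁i≈0 : n + w₁ * i ≈ 0#
    n+w₁i≈0 = -‿inverseˡ (w₁ * i)

    weights : n + 1# * i ≈ 1#
    weights = begin
      n + 1# * i              ≈⟨ +-congˡ (*-congʳ w₁+w₂≈1) ⟨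
      n + (w₁ + w₂) * i       ≈⟨ solve 4 (λ n w₁ w₂ i →
                                   n :+ (w₁ :+ w₂) :* i := (n :+ w₁ :* i) :+ w₂ :* i)
                                   refl n w₁ w₂ i ⟩
      (n + w₁ * i) + w₂ * i   ≈⟨ +-cong n+w₁i≈0 w₂i≈1 ⟩
      0# + 1#                 ≈⟨ +-identityˡ 1# ⟩
      1#                      ∎

    combination : ∀ x → Z x ≈ n * X x + (1# * i) * Y x
    combination x = sym (begin
      n * X x + (1# * i) * Y x              ≈⟨ +-congˡ (*-cong (*-identityˡ i) (Y≈ x)) ⟩
      n * X x + i * (w₁ * X x + w₂ * Z x)   ≈⟨ solve 6 (λ n i w₁ w₂ A C →
                                                 n :* A :+ i :* (w₁ :* A :+ w₂ :* C)
                                                   := (n :+ w₁ :* i) :* A :+ (w₂ :* i) :* C)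
                                                 refl n i w₁ w₂ (X x) (Z x) ⟩
      (n + w₁ * i) * X x + (w₂ * i) * Z x   ≈⟨ +-cong (*-congʳ n+w₁i≈0) (*-congʳ w₂i≈1) ⟩
      0# * X x + 1# * Z x                   ≈⟨ +-cong (zeroˡ (X x)) (*-identityˡ (Z x)) ⟩
      0# + Z x                              ≈⟨ +-identityˡ (Z x) ⟩
      Z x                                   ∎)

  AffineIn₃-swap : ∀ {S X Y Z r p q k} →
    AffineIn₃ S X Y Z r p q k → AffineIn₃ S Y X Z p r q k
  AffineIn₃-swap S≈ x = trans (S≈ x) (+-congʳ (xy∙z≈yx∙z _ _ _))

  AffineIn₃-rotate : ∀ {S X Y Z r p q k} →
    AffineIn₃ S X Y Z r p q k → AffineIn₃ S Z X Y q r p k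
  AffineIn₃-rotate S≈ x = trans (S≈ x) (+-congʳ (xy∙z≈zx∙y _ _ _))

  sum-swap : ∀ {r₁ p₁ q₁ r₂ p₂ q₂} →
    r₁ + p₁ + q₁ ≈ r₂ + p₂ + q₂ → p₁ + r₁ + q₁ ≈ p₂ + r₂ + q₂
  sum-swap sums = trans (xy∙z≈yx∙z _ _ _) (trans sums (xy∙z≈yx∙z _ _ _))

  sum-rotate : ∀ {r₁ p₁ q₁ r₂ p₂ q₂} →
    r₁ + p₁ + q₁ ≈ r₂ + p₂ + q₂ → q₁ + r₁ + p₁ ≈ q₂ + r₂ + p₂
  sum-rotate sums = trans (sym (xy∙z≈zx∙y _ _ _)) (trans sums (xy∙z≈zx∙y _ _ _))

  eliminate : ∀ {S X Y Z u v r p q k} → AffineCombination X Y Z u v →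
    AffineIn₃ S X Y Z r p q k → AffineIn₂ S Y Z (u * r + p) (v * r + q) k
  eliminate {S} {X} {Y} {Z} {u} {v} {r} {p} {q} {k} (_ , X≈) S≈ x = begin
    S x                                               ≈⟨ S≈ x ⟩
    r * X x + p * Y x + q * Z x + k                   ≈⟨ +-congʳ (+-congʳ (+-congʳ (*-congˡ (X≈ x)))) ⟩
    r * (u * Y x + v * Z x) + p * Y x + q * Z x + k   ≈⟨ solve 8 (λ u v r p q k B C →
                                                           r :* (u :* B :+ v :* C) :+ p :* B :+ q :* C :+ k
                                                             := (u :* r :+ p) :* B :+ (v :* r :+ q) :* C :+ k)
                                                           refl u v r p q k (Y x) (Z x) ⟩
    (u * r + p) * Y x + (v * r + q) * Z x + k         ∎

  eliminate-sum : ∀ {u v} → u + v ≈ 1# → ∀ r p q → (u * r + p) + (v * r + q) ≈ r + p + q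
  eliminate-sum {u} {v} u+v≈1 r p q = begin
    (u * r + p) + (v * r + q)   ≈⟨ solve 5 (λ u v r p q →
                                     (u :* r :+ p) :+ (v :* r :+ q) := (u :+ v) :* r :+ p :+ q)
                                     refl u v r p q ⟩
    (u + v) * r + p + q         ≈⟨ +-congʳ (+-congʳ (*-congʳ u+v≈1)) ⟩
    1# * r + p + q              ≈⟨ +-congʳ (+-congʳ (*-identityˡ r)) ⟩
    r + p + q                   ∎

  eliminate-pair : ∀ {S T X Y Z u v r₁ p₁ q₁ k₁ r₂ p₂ q₂ k₂} →
    AffineCombination X Y Z u v →
    AffineIn₃ S X Y Z r₁ p₁ q₁ k₁ → AffineIn₃ T X Y Z r₂ p₂ q₂ k₂ →
    r₁ + p₁ + q₁ ≈ r₂ + p₂ + q₂ →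
    BalancedPair S T Y Z (u * r₁ + p₁) (v * r₁ + q₁) k₁ (u * r₂ + p₂) (v * r₂ + q₂) k₂
  eliminate-pair affine@(u+v≈1 , _) S≈ T≈ sums =
    eliminate affine S≈ , eliminate affine T≈ ,
    trans (eliminate-sum u+v≈1 _ _ _) (trans sums (sym (eliminate-sum u+v≈1 _ _ _)))

  BalancedPair-cong : ∀ {S T Y Z p₁ q₁ k₁ p₂ q₂ k₂ p₁′ q₁′ p₂′ q₂′} →
    p₁ ≈ p₁′ → q₁ ≈ q₁′ → p₂ ≈ p₂′ → q₂ ≈ q₂′ →
    BalancedPair S T Y Z p₁ q₁ k₁ p₂ q₂ k₂ → BalancedPair S T Y Z p₁′ q₁′ k₁ p₂′ q₂′ k₂
  BalancedPair-cong p₁≈ q₁≈ p₂≈ q₂≈ (S≈ , T≈ , sums) =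
    (λ x → trans (S≈ x) (+-congʳ (+-cong (*-congʳ p₁≈) (*-congʳ q₁≈)))) ,
    (λ x → trans (T≈ x) (+-congʳ (+-cong (*-congʳ p₂≈) (*-congʳ q₂≈)))) ,
    trans (sym (+-cong p₁≈ q₁≈)) (trans sums (+-cong p₂≈ q₂≈))

lemma2 : ∀ {c ℓ} (F : Field c ℓ) → let open Field F in
  (α₁₁ α₁₂ α₁₃ α₂₁ α₂₂ α₂₃ α₃₁ α₃₂ α₃₃ α₁ α₂ α₃ : Carrier)
  (a b c : ℕ → Carrier) →
  (∀ x → a (suc x) ≈ α₁₁ * a x + α₁₂ * b x + α₁₃ * c x + α₁) →
  (∀ x → b (suc x) ≈ α₂₁ * a x + α₂₂ * b x + α₂₃ * c x + α₂) →
  (∀ x → c (suc x) ≈ α₃₁ * a x + α₃₂ * b x + α₃₃ * c x + α₃) →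
  α₁₁ + α₁₂ + α₁₃ ≈ α₂₁ + α₂₂ + α₂₃ →
  α₂₁ + α₂₂ + α₂₃ ≈ α₃₁ + α₃₂ + α₃₃ →
  (w₁ w₂ : Carrier) → w₁ + w₂ ≈ 1# →
  (∀ x → b x ≈ w₁ * a x + w₂ * c x) →
  -- (i)
  ((h₂ : ¬ (w₂ ≈ 0#)) →
    let β₁₁ = α₁₁ - div w₁ w₂ h₂ * α₁₃
        β₁₂ = α₁₂ + div 1# w₂ h₂ * α₁₃
        β₂₁ = α₂₁ - div w₁ w₂ h₂ * α₂₃
        β₂₂ = α₂₂ + div 1# w₂ h₂ * α₂₃
    in (∀ x → a (suc x) ≈ β₁₁ * a x + β₁₂ * b x + α₁)
     × (∀ x → b (suc x) ≈ β₂₁ * a x + β₂₂ * b x + α₂)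
     × (β₁₁ + β₁₂ ≈ β₂₁ + β₂₂))
  ×
  -- (ii)
  (let β₁₁ = α₁₁ + w₁ * α₁₂
       β₁₂ = w₂ * α₁₂ + α₁₃
       β₂₁ = α₃₁ + w₁ * α₃₂
       β₂₂ = w₂ * α₃₂ + α₃₃
   in (∀ x → a (suc x) ≈ β₁₁ * a x + β₁₂ * c x + α₁)
    × (∀ x → c (suc x) ≈ β₂₁ * a x + β₂₂ * c x + α₃)
    × (β₁₁ + β₁₂ ≈ β₂₁ + β₂₂))
  ×
  -- (iii)
  ((h₁ : ¬ (w₁ ≈ 0#)) →
    let β₁₁ = div 1# w₁ h₁ * α₂₁ + α₂₂
        β₁₂ = - (div w₂ w₁ h₁) * α₂₁ + α₂₃
        β₂₁ = div 1# w₁ h₁ * α₃₁ + α₃₂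
        β₂₂ = - (div w₂ w₁ h₁) * α₃₁ + α₃₃
    in (∀ x → b (suc x) ≈ β₁₁ * b x + β₁₂ * c x + α₂)
     × (∀ x → c (suc x) ≈ β₂₁ * b x + β₂₂ * c x + α₃)
     × (β₁₁ + β₁₂ ≈ β₂₁ + β₂₂))
lemma2 F α₁₁ α₁₂ α₁₃ α₂₁ α₂₂ α₂₃ α₃₁ α₃₂ α₃₃ α₁ α₂ α₃ a b c
       a-step b-step c-step sums₁₂ sums₂₃ w₁ w₂ w₁+w₂≈1 b-combination =
  without-c , without-b , without-a
  where
  open Field F
  open AffineElimination commutativeRing ℕ
  open import Algebra.Properties.Ring ring using (-‿distribˡ-*)

  b-affine : AffineCombination b a c w₁ w₂
  b-affine = w₁+w₂≈1 , b-combination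

  negated-coefficient : ∀ d r p → - d * r + p ≈ p - d * r
  negated-coefficient d r p = trans (+-comm _ _) (+-congˡ (sym (-‿distribˡ-* d r)))

  c-affine : (h₂ : ¬ (w₂ ≈ 0#)) →
    AffineCombination c a b (- div w₁ w₂ h₂) (div 1# w₂ h₂)
  c-affine h₂ = AffineCombination-isolate (inverse w₂ h₂) b-affine

  a-affine : (h₁ : ¬ (w₁ ≈ 0#)) →
    AffineCombination a b c (div 1# w₁ h₁) (- div w₂ w₁ h₁)
  a-affine h₁ = AffineCombination-swap
    (AffineCombination-isolate (inverse w₁ h₁) (AffineCombination-swap b-affine))

  without-c = λ h₂ →
    BalancedPair-cong (negated-coefficient _ _ _) (+-comm _ _) (negated-coefficient _ _ _) (+-comm _ _)
      (eliminate-pair (c-affine h₂)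
        (AffineIn₃-rotate a-step) (AffineIn₃-rotate b-step) (sum-rotate sums₁₂))

  without-b =
    BalancedPair-cong (+-comm _ _) refl (+-comm _ _) refl
      (eliminate-pair b-affine
        (AffineIn₃-swap a-step) (AffineIn₃-swap c-step) (sum-swap (trans sums₁₂ sums₂₃)))

  without-a = λ h₁ → eliminate-pair (a-affine h₁) b-step c-step sums₂₃
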